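{- Let $h \colon K_1 \to K_2$ be a fully-continuous homomorphism on absorptive, fully-continuous semirings. Let $\mathcal{E} \colon (X_i = P_i)_{1 \le i \le n}$ be a polynomial equation system over $K_1$. Let $h(\mathcal{E}) \colon (X_i = h(P_i))_{1 \le i \le n}$ result from $\mathcal{E}$ by applying $h$ to all coefficients. Then, $\mathrm{lfp}(F_{h(\mathcal{E})}) = h(\mathrm{lfp}(F_\mathcal{E}))$ and $\mathrm{gfp}(F_{h(\mathcal{E})}) = h(\mathrm{gfp}(F_\mathcal{E}))$.
   Context: A commutative semiring is absorptive if $1+a=1$ for all $a$; its natural order is $a\le b$ iff $a+b=b$. It is fully continuous if the natural order is a complete lattice and for all $a$, all nonempty chains $C$ and $\circ\in\{+,\cdot\}$: $\sup(a\circ C)=a\circ\sup C$ and $\inf(a\circ C)=a\circ\inf C$. A semiring homomorphism $h$ is fully continuous if $h(\sup C)=\sup h(C)$ and $h(\inf C)=\inf h(C)$ for all nonempty chains $C\subseteq K_1$. A polynomial equation system $X_i = P_i(X_1,\dots,X_n)$ has polynomials $P_i$ (finite sums of coefficient–monomial terms) over the semiring; $F_\mathcal{E}$ is the induced operator $F_\mathcal{E}(\mathbf a)_{X_i} = P_i(\mathbf a)$, and $\mathrm{lfp}$/$\mathrm{gfp}$ denote its least/greatest fixed points w.r.t. the componentwise natural order; $h$ is applied componentwise to tuples. -}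

module Defs where

open import Level using (Level; _⊔_) renaming (suc to lsuc)
open import Data.Nat using (ℕ; zero; suc)
open import Data.Fin using (Fin) renaming (zero to fzero; suc to fsuc)
open import Data.List using (List; []; _∷_; map)
open import Data.Product using (Σ; _×_; _,_; ∃)
open import Data.Sum using (_⊎_)
open import Relation.Unary using (Pred)
open import Algebra.Bundles using (CommutativeSemiring)
open import Algebra.Morphism.Structures using (module SemiringMorphisms)

module _ {c ℓ : Level} (K : CommutativeSemiring c ℓ) where
  open CommutativeSemiring K

  _≤ₙ_ : Carrier → Carrier → Set ℓ
  a ≤ₙ b = (a + b) ≈ b

  Absorptive : Set (c ⊔ ℓ)
  Absorptive = ∀ a → (1# + a) ≈ 1#

  Subset : Set (lsuc (c ⊔ ℓ))
  Subset = Pred Carrier (c ⊔ ℓ)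

  IsUpperBound : Subset → Carrier → Set (c ⊔ ℓ)
  IsUpperBound S x = ∀ y → S y → y ≤ₙ x

  IsLowerBound : Subset → Carrier → Set (c ⊔ ℓ)
  IsLowerBound S x = ∀ y → S y → x ≤ₙ y

  IsSup : Subset → Carrier → Set (c ⊔ ℓ)
  IsSup S x = IsUpperBound S x × (∀ z → IsUpperBound S z → x ≤ₙ z)

  IsInf : Subset → Carrier → Set (c ⊔ ℓ)
  IsInf S x = IsLowerBound S x × (∀ z → IsLowerBound S z → z ≤ₙ x)

  IsCompleteLattice : Set (lsuc (c ⊔ ℓ))
  IsCompleteLattice = ∀ (S : Subset) → (∃ λ x → IsSup S x) × (∃ λ x → IsInf S x)

  Nonempty : Subset → Set (c ⊔ ℓ)
  Nonempty C = ∃ λ x → C x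

  IsChain : Subset → Set (c ⊔ ℓ)
  IsChain C = ∀ x y → C x → C y → (x ≤ₙ y) ⊎ (y ≤ₙ x)

  image : (Carrier → Carrier) → Subset → Subset
  image f C y = ∃ λ x → C x × (f x ≈ y)

  ContinuousOp : (Carrier → Carrier → Carrier) → Set (lsuc (c ⊔ ℓ))
  ContinuousOp _∘_ = ∀ (a : Carrier) (C : Subset) → Nonempty C → IsChain C →
    (∀ s → IsSup C s → IsSup (image (a ∘_) C) (a ∘ s)) ×
    (∀ i → IsInf C i → IsInf (image (a ∘_) C) (a ∘ i))

  FullyContinuous : Set (lsuc (c ⊔ ℓ))
  FullyContinuous = IsCompleteLattice × ContinuousOp _+_ × ContinuousOp _*_

  -- polynomials in n variables: finite sums of coefficient–monomial terms;
  -- a monomial is given by its exponent vector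
  Monomial : ℕ → Set
  Monomial n = Fin n → ℕ

  Poly : ℕ → Set c
  Poly n = List (Carrier × Monomial n)

  pow : Carrier → ℕ → Carrier
  pow x zero = 1#
  pow x (suc k) = x * pow x k

  evalMono : ∀ {n} → Monomial n → (Fin n → Carrier) → Carrier
  evalMono {zero} e a = 1#
  evalMono {suc n} e a = pow (a fzero) (e fzero) * evalMono (λ i → e (fsuc i)) (λ i → a (fsuc i))

  evalPoly : ∀ {n} → Poly n → (Fin n → Carrier) → Carrier
  evalPoly [] a = 0#
  evalPoly ((k , e) ∷ P) a = (k * evalMono e a) + evalPoly P a

  EqSystem : ℕ → Set c
  EqSystem n = Fin n → Poly n

  F : ∀ {n} → EqSystem n → (Fin n → Carrier) → (Fin n → Carrier)
  F E a i = evalPoly (E i) a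

  _≤ᵥ_ : ∀ {n} → (Fin n → Carrier) → (Fin n → Carrier) → Set ℓ
  a ≤ᵥ b = ∀ i → a i ≤ₙ b i

  _≈ᵥ_ : ∀ {n} → (Fin n → Carrier) → (Fin n → Carrier) → Set ℓ
  a ≈ᵥ b = ∀ i → a i ≈ b i

  IsLfp : ∀ {n} → ((Fin n → Carrier) → (Fin n → Carrier)) → (Fin n → Carrier) → Set (c ⊔ ℓ)
  IsLfp G a = (G a ≈ᵥ a) × (∀ b → G b ≈ᵥ b → a ≤ᵥ b)

  IsGfp : ∀ {n} → ((Fin n → Carrier) → (Fin n → Carrier)) → (Fin n → Carrier) → Set (c ⊔ ℓ)
  IsGfp G a = (G a ≈ᵥ a) × (∀ b → G b ≈ᵥ b → b ≤ᵥ a)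

module _ {c ℓ : Level} (K₁ K₂ : CommutativeSemiring c ℓ) where
  private
    module K₁ = CommutativeSemiring K₁
    module K₂ = CommutativeSemiring K₂
  open SemiringMorphisms K₁.rawSemiring K₂.rawSemiring

  IsFullyContinuousHom : (K₁.Carrier → K₂.Carrier) → Set (lsuc (c ⊔ ℓ))
  IsFullyContinuousHom h = IsSemiringHomomorphism h ×
    (∀ (C : Subset K₁) → Nonempty K₁ C → IsChain K₁ C →
      (∀ s → IsSup K₁ C s → IsSup K₂ (λ y → ∃ λ x → C x × (h x K₂.≈ y)) (h s)) ×
      (∀ i → IsInf K₁ C i → IsInf K₂ (λ y → ∃ λ x → C x × (h x K₂.≈ y)) (h i)))

  mapSystem : ∀ {n} → (K₁.Carrier → K₂.Carrier) → EqSystem K₁ n → EqSystem K₂ n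
  mapSystem h E i = map (λ { (k , e) → (h k , e) }) (E i)

{-# OPTIONS --safe #-}
-- In an absorptive semiring both the natural order (bottom 0) and its dual (bottom 1, by
-- absorption) make + and * preserve lubs of chains. So, by Kleene's theorem for either order,
-- the least fixed point of F_E is the lub of the iterates of F_E from the bottom, and the greatest
-- fixed point is the least one for the dual order. The homomorphism h maps the bottom and the
-- iterates of F_E to those of F_h(E), and, being continuous, their lub to the lub.
module Submission where

open import Defs
open import Level using (Level; Lift; lift; _⊔_) renaming (suc to lsuc)
open import Function using (_∘_; flip)
open import Data.Nat using (ℕ; zero; suc; _≤_; _≤′_; ≤′-refl; ≤′-step) renaming (_⊔_ to _⊔ℕ_)
open import Data.Nat.Properties using (≤-total; ≤⇒≤′; m≤m⊔n; m≤n⊔m)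
open import Data.Fin using (Fin) renaming (zero to fzero; suc to fsuc)
open import Data.List using ([]; _∷_; map)
open import Data.Product using (_×_; _,_; ∃; proj₁; proj₂; map₁)
open import Data.Sum using (_⊎_; inj₁; inj₂; swap)
open import Algebra.Core using (Op₂)
open import Algebra.Bundles using (CommutativeSemiring)
open import Algebra.Morphism.Structures using (module SemiringMorphisms)
open import Relation.Binary.Core using (Rel; _Preserves_⟶_)
open import Relation.Binary.Definitions using (Monotonic₂)
open import Relation.Binary.Structures using (IsPartialOrder)
import Relation.Binary.Construct.Flip.EqAndOrd as Flip

module _ {c ℓ : Level} (K : CommutativeSemiring c ℓ) where
  open CommutativeSemiring K

  IsLub : Rel Carrier ℓ → Subset K → Carrier → Set (c ⊔ ℓ)
  IsLub _⊑_ S x = (∀ y → S y → y ⊑ x) × (∀ z → (∀ y → S y → y ⊑ z) → x ⊑ z)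

  IsChainOf : Rel Carrier ℓ → Subset K → Set (c ⊔ ℓ)
  IsChainOf _⊑_ C = ∀ x y → C x → C y → (x ⊑ y) ⊎ (y ⊑ x)

  isChainOf-flip : ∀ {_⊑_ C} → IsChainOf (flip _⊑_) C → IsChainOf _⊑_ C
  isChainOf-flip chain x y cx cy = swap (chain x y cx cy)

  LubContinuous : Rel Carrier ℓ → Op₂ Carrier → Set (lsuc (c ⊔ ℓ))
  LubContinuous _⊑_ _∙_ = ∀ a C → Nonempty K C → IsChainOf _⊑_ C →
    ∀ s → IsLub _⊑_ C s → IsLub _⊑_ (image K (a ∙_) C) (a ∙ s)

  range : (ℕ → Carrier) → Subset K
  range f y = Lift c (∃ λ k → f k ≈ y)

  record ChainContinuousOrder : Set (lsuc (c ⊔ ℓ)) where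
    field
      _⊑_            : Rel Carrier ℓ
      isPartialOrder : IsPartialOrder _≈_ _⊑_
      +-continuous   : LubContinuous _⊑_ _+_
      *-continuous   : LubContinuous _⊑_ _*_
      ⊥              : Carrier
      ⊥-least        : ∀ x → ⊥ ⊑ x

module ChainContinuousOrderProperties
  {c ℓ : Level} {K : CommutativeSemiring c ℓ} (O : ChainContinuousOrder K) where
  open CommutativeSemiring K
  open ChainContinuousOrder O public
  open IsPartialOrder isPartialOrder using () renaming
    (refl to ⊑-refl; reflexive to ⊑-reflexive; trans to ⊑-trans; antisym to ⊑-antisym;
     ≲-respˡ-≈ to ⊑-respˡ-≈; ≲-respʳ-≈ to ⊑-respʳ-≈)

  isLub-unique : ∀ {S x y} → IsLub K _⊑_ S x → IsLub K _⊑_ S y → x ≈ y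
  isLub-unique (x-ub , x-least) (y-ub , y-least) = ⊑-antisym (x-least _ y-ub) (y-least _ x-ub)

  isLub-respʳ-≈ : ∀ {S x y} → x ≈ y → IsLub K _⊑_ S x → IsLub K _⊑_ S y
  isLub-respʳ-≈ x≈y (ub , least) =
    (λ z sz → ⊑-respʳ-≈ x≈y (ub z sz)) , (λ z z-ub → ⊑-respˡ-≈ x≈y (least z z-ub))

  _IsCofinalIn_ : Subset K → Subset K → Set (c ⊔ ℓ)
  T IsCofinalIn S = ∀ y → S y → ∃ λ y′ → T y′ × y ⊑ y′

  isLub-cofinal : ∀ {S T x} → T IsCofinalIn S → S IsCofinalIn T → IsLub K _⊑_ S x → IsLub K _⊑_ T x
  isLub-cofinal T-cofinal S-cofinal (ub , least) =
    (λ y ty → let y′ , sy′ , y⊑y′ = S-cofinal y ty in ⊑-trans y⊑y′ (ub y′ sy′)) ,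
    (λ z z-ub → least z λ y sy → let y′ , ty′ , y⊑y′ = T-cofinal y sy in ⊑-trans y⊑y′ (z-ub y′ ty′))

  continuous⇒monotoneʳ : ∀ {_∙_} → LubContinuous K _⊑_ _∙_ → ∀ a {x y} → x ⊑ y → (a ∙ x) ⊑ (a ∙ y)
  continuous⇒monotoneʳ {_∙_} continuous a {x} {y} x⊑y =
    proj₁ (continuous a pair (x , lift (inj₁ refl)) pair-chain y y-lub) (a ∙ x) (x , lift (inj₁ refl) , refl)
    where
    pair : Subset K
    pair z = Lift c ((z ≈ x) ⊎ (z ≈ y))

    x-least : ∀ {w} → pair w → x ⊑ w
    x-least (lift (inj₁ w≈x)) = ⊑-reflexive (sym w≈x)
    x-least (lift (inj₂ w≈y)) = ⊑-respʳ-≈ (sym w≈y) x⊑y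

    y-greatest : ∀ {w} → pair w → w ⊑ y
    y-greatest (lift (inj₁ w≈x)) = ⊑-respˡ-≈ (sym w≈x) x⊑y
    y-greatest (lift (inj₂ w≈y)) = ⊑-reflexive w≈y

    pair-chain : IsChainOf K _⊑_ pair
    pair-chain z w (lift (inj₁ z≈x)) pw = inj₁ (⊑-respˡ-≈ (sym z≈x) (x-least pw))
    pair-chain z w (lift (inj₂ z≈y)) pw = inj₂ (⊑-respʳ-≈ (sym z≈y) (y-greatest pw))

    y-lub : IsLub K _⊑_ pair y
    y-lub = (λ w pw → y-greatest pw) , (λ z z-ub → z-ub y (lift (inj₂ refl)))

  Ascending : (ℕ → Carrier) → Set ℓ
  Ascending f = ∀ k → f k ⊑ f (suc k)

  IsSeqLub : (ℕ → Carrier) → Carrier → Set (c ⊔ ℓ)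
  IsSeqLub f = IsLub K _⊑_ (range K f)

  ascending-mono′ : ∀ {f} → Ascending f → ∀ {k j} → k ≤′ j → f k ⊑ f j
  ascending-mono′ f↑ ≤′-refl = ⊑-refl
  ascending-mono′ f↑ (≤′-step k≤′j) = ⊑-trans (ascending-mono′ f↑ k≤′j) (f↑ _)

  ascending-mono : ∀ {f} → Ascending f → ∀ {k j} → k ≤ j → f k ⊑ f j
  ascending-mono f↑ = ascending-mono′ f↑ ∘ ≤⇒≤′

  range-nonempty : ∀ f → Nonempty K (range K f)
  range-nonempty f = f 0 , lift (0 , refl)

  ascending⇒chain : ∀ {f} → Ascending f → IsChainOf K _⊑_ (range K f)
  ascending⇒chain {f} f↑ x y (lift (k , fk≈x)) (lift (j , fj≈y)) with ≤-total k j
  ... | inj₁ k≤j = inj₁ (⊑-respʳ-≈ fj≈y (⊑-respˡ-≈ fk≈x (ascending-mono f↑ k≤j)))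
  ... | inj₂ j≤k = inj₂ (⊑-respʳ-≈ fk≈x (⊑-respˡ-≈ fj≈y (ascending-mono f↑ j≤k)))

  const-isSeqLub : ∀ a → IsSeqLub (λ _ → a) a
  const-isSeqLub a = (λ y (lift (_ , a≈y)) → ⊑-reflexive (sym a≈y)) , (λ z z-ub → z-ub a (lift (0 , refl)))

  isSeqLub-cong : ∀ {f g s} → (∀ k → f k ≈ g k) → IsSeqLub f s → IsSeqLub g s
  isSeqLub-cong {f} {g} f≈g = isLub-cofinal
    (λ y (lift (k , fk≈y)) → y , lift (k , trans (sym (f≈g k)) fk≈y) , ⊑-refl)
    (λ y (lift (k , gk≈y)) → y , lift (k , trans (f≈g k) gk≈y) , ⊑-refl)

  isLub-image-range : (K′ : CommutativeSemiring c ℓ) (g : CommutativeSemiring.Carrier K′ → Carrier) →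
    g Preserves CommutativeSemiring._≈_ K′ ⟶ _≈_ → ∀ f {s} →
    IsLub K _⊑_ (λ y → ∃ λ x → range K′ f x × g x ≈ y) s → IsSeqLub (g ∘ f) s
  isLub-image-range K′ g g-cong f = isLub-cofinal
    (λ y (x , lift (k , fk≈x) , gx≈y) → y , lift (k , trans (g-cong fk≈x) gx≈y) , ⊑-refl)
    (λ y (lift (k , gfk≈y)) → g (f k) , (f k , lift (k , CommutativeSemiring.refl K′) , refl) , ⊑-reflexive (sym gfk≈y))

  module LubContinuousOperator
    (_∙_ : Op₂ Carrier)
    (∙-comm : ∀ x y → (x ∙ y) ≈ (y ∙ x))
    (∙-cong : ∀ {x y u v} → x ≈ y → u ≈ v → (x ∙ u) ≈ (y ∙ v))
    (∙-continuous : LubContinuous K _⊑_ _∙_) where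

    ∙-mono : Monotonic₂ _⊑_ _⊑_ _⊑_ _∙_
    ∙-mono {x} {y} {u} {v} x⊑y u⊑v = ⊑-trans
      (⊑-respˡ-≈ (∙-comm u x) (⊑-respʳ-≈ (∙-comm u y) (continuous⇒monotoneʳ ∙-continuous u x⊑y)))
      (continuous⇒monotoneʳ ∙-continuous y u⊑v)

    ∙-isSeqLubʳ : ∀ a {f s} → Ascending f → IsSeqLub f s → IsSeqLub (λ k → a ∙ f k) (a ∙ s)
    ∙-isSeqLubʳ a {f} f↑ f-lub = isLub-image-range K (a ∙_) (∙-cong refl) f
      (∙-continuous a (range K f) (range-nonempty f) (ascending⇒chain f↑) _ f-lub)

    ∙-isSeqLub : ∀ {f g s t} → Ascending f → Ascending g → IsSeqLub f s → IsSeqLub g t →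
      IsSeqLub (λ k → f k ∙ g k) (s ∙ t)
    ∙-isSeqLub {f} {g} {s} {t} f↑ g↑ f-lub@(f-ub , _) g-lub@(g-ub , _) = ub , least
      where
      ub : ∀ y → range K (λ k → f k ∙ g k) y → y ⊑ (s ∙ t)
      ub y (lift (k , fk∙gk≈y)) =
        ⊑-respˡ-≈ fk∙gk≈y (∙-mono (f-ub (f k) (lift (k , refl))) (g-ub (g k) (lift (k , refl))))

      least : ∀ z → (∀ y → range K (λ k → f k ∙ g k) y → y ⊑ z) → (s ∙ t) ⊑ z
      least z z-ub = ⊑-respˡ-≈ (∙-comm t s) (proj₂ (∙-isSeqLubʳ t f↑ f-lub) z λ where
          y (lift (k , t∙fk≈y)) → ⊑-respˡ-≈ (trans (∙-comm (f k) t) t∙fk≈y) (fk∙t⊑z k))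
        where
        fk∙t⊑z : ∀ k → (f k ∙ t) ⊑ z
        fk∙t⊑z k = proj₂ (∙-isSeqLubʳ (f k) g↑ g-lub) z λ where
          y (lift (j , fk∙gj≈y)) → ⊑-respˡ-≈ fk∙gj≈y (⊑-trans
            (∙-mono (ascending-mono f↑ (m≤m⊔n k j)) (ascending-mono g↑ (m≤n⊔m k j)))
            (z-ub _ (lift (k ⊔ℕ j , refl))))

  open LubContinuousOperator _+_ +-comm +-cong +-continuous
    using () renaming (∙-mono to +-mono; ∙-isSeqLub to +-isSeqLub)
  open LubContinuousOperator _*_ *-comm *-cong *-continuous
    using () renaming (∙-mono to *-mono; ∙-isSeqLub to *-isSeqLub)

  _⊑ᵥ_ : ∀ {n} → Rel (Fin n → Carrier) ℓ
  u ⊑ᵥ v = ∀ i → u i ⊑ v i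

  Ascendingᵥ : ∀ {n} → (ℕ → Fin n → Carrier) → Set ℓ
  Ascendingᵥ v = ∀ k → v k ⊑ᵥ v (suc k)

  IsSeqLubᵥ : ∀ {n} → (ℕ → Fin n → Carrier) → (Fin n → Carrier) → Set (c ⊔ ℓ)
  IsSeqLubᵥ v s = ∀ i → IsSeqLub (λ k → v k i) (s i)

  pow-mono : ∀ m {x y} → x ⊑ y → pow K x m ⊑ pow K y m
  pow-mono zero x⊑y = ⊑-refl
  pow-mono (suc m) x⊑y = *-mono x⊑y (pow-mono m x⊑y)

  evalMono-mono : ∀ {n} (e : Monomial K n) {u v} → u ⊑ᵥ v → evalMono K e u ⊑ evalMono K e v
  evalMono-mono {zero} e u⊑v = ⊑-refl
  evalMono-mono {suc n} e u⊑v =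
    *-mono (pow-mono (e fzero) (u⊑v fzero)) (evalMono-mono (e ∘ fsuc) (u⊑v ∘ fsuc))

  evalPoly-mono : ∀ {n} (P : Poly K n) {u v} → u ⊑ᵥ v → evalPoly K P u ⊑ evalPoly K P v
  evalPoly-mono [] u⊑v = ⊑-refl
  evalPoly-mono ((a , e) ∷ P) u⊑v = +-mono (*-mono ⊑-refl (evalMono-mono e u⊑v)) (evalPoly-mono P u⊑v)

  evalPoly-cong : ∀ {n} (P : Poly K n) {u v} → _≈ᵥ_ K u v → evalPoly K P u ≈ evalPoly K P v
  evalPoly-cong P u≈v = ⊑-antisym (evalPoly-mono P (⊑-reflexive ∘ u≈v)) (evalPoly-mono P (⊑-reflexive ∘ sym ∘ u≈v))

  pow-isSeqLub : ∀ {f s} → Ascending f → IsSeqLub f s → ∀ m → IsSeqLub (λ k → pow K (f k) m) (pow K s m)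
  pow-isSeqLub f↑ f-lub zero = const-isSeqLub 1#
  pow-isSeqLub f↑ f-lub (suc m) = *-isSeqLub f↑ (pow-mono m ∘ f↑) f-lub (pow-isSeqLub f↑ f-lub m)

  evalMono-isSeqLub : ∀ {n} (e : Monomial K n) {v s} → Ascendingᵥ v → IsSeqLubᵥ v s →
    IsSeqLub (λ k → evalMono K e (v k)) (evalMono K e s)
  evalMono-isSeqLub {zero} e v↑ v-lub = const-isSeqLub 1#
  evalMono-isSeqLub {suc n} e v↑ v-lub = *-isSeqLub
    (λ k → pow-mono (e fzero) (v↑ k fzero)) (λ k → evalMono-mono (e ∘ fsuc) (v↑ k ∘ fsuc))
    (pow-isSeqLub (λ k → v↑ k fzero) (v-lub fzero) (e fzero))
    (evalMono-isSeqLub (e ∘ fsuc) (λ k → v↑ k ∘ fsuc) (v-lub ∘ fsuc))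

  evalPoly-isSeqLub : ∀ {n} (P : Poly K n) {v s} → Ascendingᵥ v → IsSeqLubᵥ v s →
    IsSeqLub (λ k → evalPoly K P (v k)) (evalPoly K P s)
  evalPoly-isSeqLub [] v↑ v-lub = const-isSeqLub 0#
  evalPoly-isSeqLub ((a , e) ∷ P) v↑ v-lub = +-isSeqLub
    (λ k → *-mono ⊑-refl (evalMono-mono e (v↑ k))) (λ k → evalPoly-mono P (v↑ k))
    (*-isSeqLub (λ _ → ⊑-refl) (λ k → evalMono-mono e (v↑ k)) (const-isSeqLub a) (evalMono-isSeqLub e v↑ v-lub))
    (evalPoly-isSeqLub P v↑ v-lub)

  IsLeastFixedPoint : ∀ {n} → ((Fin n → Carrier) → (Fin n → Carrier)) → (Fin n → Carrier) → Set (c ⊔ ℓ)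
  IsLeastFixedPoint G a = _≈ᵥ_ K (G a) a × (∀ b → _≈ᵥ_ K (G b) b → a ⊑ᵥ b)

  module Kleene {n} (E : EqSystem K n) where

    iterate : ℕ → Fin n → Carrier
    iterate zero _ = ⊥
    iterate (suc k) = F K E (iterate k)

    iterate-ascending : Ascendingᵥ iterate
    iterate-ascending zero i = ⊥-least _
    iterate-ascending (suc k) i = evalPoly-mono (E i) (iterate-ascending k)

    iterate-below-fixedPoint : ∀ {b} → _≈ᵥ_ K (F K E b) b → ∀ k → iterate k ⊑ᵥ b
    iterate-below-fixedPoint Fb≈b zero i = ⊥-least _
    iterate-below-fixedPoint Fb≈b (suc k) i =
      ⊑-respʳ-≈ (Fb≈b i) (evalPoly-mono (E i) (iterate-below-fixedPoint Fb≈b k))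

    lub-isLeastFixedPoint : ∀ {s} → IsSeqLubᵥ iterate s → IsLeastFixedPoint (F K E) s
    lub-isLeastFixedPoint {s} s-lub = Fs≈s , s-least
      where
      -- F s and s are both lubs of the iterates, F s by continuity and s as the lub of their tail.
      Fs≈s : _≈ᵥ_ K (F K E s) s
      Fs≈s i = isLub-unique (evalPoly-isSeqLub (E i) iterate-ascending s-lub) (isSeqLub-tail (s-lub i))
        where
        isSeqLub-tail : IsSeqLub (λ k → iterate k i) (s i) → IsSeqLub (λ k → iterate (suc k) i) (s i)
        isSeqLub-tail = isLub-cofinal
          (λ y (lift (k , it≈y)) → iterate (suc k) i , lift (k , refl) , ⊑-respˡ-≈ it≈y (iterate-ascending k i))
          (λ y (lift (k , it≈y)) → y , lift (suc k , it≈y) , ⊑-refl)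

      s-least : ∀ b → _≈ᵥ_ K (F K E b) b → s ⊑ᵥ b
      s-least b Fb≈b i = proj₂ (s-lub i) (b i)
        λ y (lift (k , it≈y)) → ⊑-respˡ-≈ it≈y (iterate-below-fixedPoint Fb≈b k i)

    isLeastFixedPoint⇒lub : ∀ {s a} → IsSeqLubᵥ iterate s → IsLeastFixedPoint (F K E) a → IsSeqLubᵥ iterate a
    isLeastFixedPoint⇒lub {s} {a} s-lub (Fa≈a , a-least) i = isLub-respʳ-≈ s≈a (s-lub i)
      where
      s-lfp : IsLeastFixedPoint (F K E) s
      s-lfp = lub-isLeastFixedPoint s-lub

      s≈a : s i ≈ a i
      s≈a = ⊑-antisym (proj₂ s-lfp _ Fa≈a i) (a-least s (proj₁ s-lfp) i)

module SemiringHomomorphismProperties {c ℓ : Level} {K₁ K₂ : CommutativeSemiring c ℓ}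
  {h : CommutativeSemiring.Carrier K₁ → CommutativeSemiring.Carrier K₂}
  (h-homo : SemiringMorphisms.IsSemiringHomomorphism
              (CommutativeSemiring.rawSemiring K₁) (CommutativeSemiring.rawSemiring K₂) h) where
  private
    module K₁ = CommutativeSemiring K₁
    module K₂ = CommutativeSemiring K₂
  open SemiringMorphisms.IsSemiringHomomorphism h-homo
  open import Relation.Binary.Reasoning.Setoid K₂.setoid

  pow-homo : ∀ x m → h (pow K₁ x m) K₂.≈ pow K₂ (h x) m
  pow-homo x zero = 1#-homo
  pow-homo x (suc m) = K₂.trans (*-homo x _) (K₂.*-cong K₂.refl (pow-homo x m))

  evalMono-homo : ∀ {n} (e : Monomial K₁ n) v → h (evalMono K₁ e v) K₂.≈ evalMono K₂ e (h ∘ v)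
  evalMono-homo {zero} e v = 1#-homo
  evalMono-homo {suc n} e v = begin
    h (pow K₁ (v fzero) (e fzero) K₁.* evalMono K₁ (e ∘ fsuc) (v ∘ fsuc))
      ≈⟨ *-homo _ _ ⟩
    h (pow K₁ (v fzero) (e fzero)) K₂.* h (evalMono K₁ (e ∘ fsuc) (v ∘ fsuc))
      ≈⟨ K₂.*-cong (pow-homo (v fzero) (e fzero)) (evalMono-homo (e ∘ fsuc) (v ∘ fsuc)) ⟩
    pow K₂ (h (v fzero)) (e fzero) K₂.* evalMono K₂ (e ∘ fsuc) (h ∘ v ∘ fsuc)
      ∎

  evalPoly-homo : ∀ {n} (P : Poly K₁ n) v → h (evalPoly K₁ P v) K₂.≈ evalPoly K₂ (map (map₁ h) P) (h ∘ v)
  evalPoly-homo [] v = 0#-homo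
  evalPoly-homo ((a , e) ∷ P) v = begin
    h (a K₁.* evalMono K₁ e v K₁.+ evalPoly K₁ P v)
      ≈⟨ +-homo _ _ ⟩
    h (a K₁.* evalMono K₁ e v) K₂.+ h (evalPoly K₁ P v)
      ≈⟨ K₂.+-cong (*-homo _ _) (evalPoly-homo P v) ⟩
    h a K₂.* h (evalMono K₁ e v) K₂.+ evalPoly K₂ (map (map₁ h) P) (h ∘ v)
      ≈⟨ K₂.+-cong (K₂.*-cong K₂.refl (evalMono-homo e v)) K₂.refl ⟩
    h a K₂.* evalMono K₂ e (h ∘ v) K₂.+ evalPoly K₂ (map (map₁ h) P) (h ∘ v)
      ∎

module _ {c ℓ : Level} {K₁ K₂ : CommutativeSemiring c ℓ}
  (O₁ : ChainContinuousOrder K₁) (O₂ : ChainContinuousOrder K₂) where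
  private
    module K₁ = CommutativeSemiring K₁
    module K₂ = CommutativeSemiring K₂
    module O₁ = ChainContinuousOrderProperties O₁
    module O₂ = ChainContinuousOrderProperties O₂
  open SemiringMorphisms K₁.rawSemiring K₂.rawSemiring using (IsSemiringHomomorphism)

  chainContinuous⇒seqContinuous : ∀ {h} → h Preserves K₁._≈_ ⟶ K₂._≈_ →
    (∀ C → Nonempty K₁ C → IsChainOf K₁ O₁._⊑_ C →
       ∀ s → IsLub K₁ O₁._⊑_ C s → IsLub K₂ O₂._⊑_ (λ y → ∃ λ x → C x × h x K₂.≈ y) (h s)) →
    ∀ {f s} → O₁.Ascending f → O₁.IsSeqLub f s → O₂.IsSeqLub (h ∘ f) (h s)
  chainContinuous⇒seqContinuous {h} h-cong h-continuous {f} f↑ f-lub = O₂.isLub-image-range K₁ h h-cong f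
    (h-continuous (range K₁ f) (O₁.range-nonempty f) (O₁.ascending⇒chain f↑) _ f-lub)

  isLeastFixedPoint-map : ∀ {h} → IsSemiringHomomorphism h → h O₁.⊥ K₂.≈ O₂.⊥ →
    (∀ {f s} → O₁.Ascending f → O₁.IsSeqLub f s → O₂.IsSeqLub (h ∘ f) (h s)) →
    (∀ f → O₁.Ascending f → ∃ (O₁.IsSeqLub f)) →
    ∀ {n} (E : EqSystem K₁ n) a → O₁.IsLeastFixedPoint (F K₁ E) a →
    O₂.IsLeastFixedPoint (F K₂ (mapSystem K₁ K₂ h E)) (h ∘ a)
  isLeastFixedPoint-map {h} h-homo h-⊥ h-continuous ω-complete E a a-lfp =
    I₂.lub-isLeastFixedPoint λ i →
      O₂.isSeqLub-cong (λ k → iterate-map k i) (h-continuous (λ k → I₁.iterate-ascending k i) (a-lub i))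
    where
    module I₁ = O₁.Kleene E
    module I₂ = O₂.Kleene (mapSystem K₁ K₂ h E)
    open SemiringHomomorphismProperties h-homo using (evalPoly-homo)

    iterate-map : ∀ k i → h (I₁.iterate k i) K₂.≈ I₂.iterate k i
    iterate-map zero i = h-⊥
    iterate-map (suc k) i =
      K₂.trans (evalPoly-homo (E i) (I₁.iterate k)) (O₂.evalPoly-cong (mapSystem K₁ K₂ h E i) (iterate-map k))

    iterate-lub : ∀ i → ∃ (O₁.IsSeqLub (λ k → I₁.iterate k i))
    iterate-lub i = ω-complete _ (λ k → I₁.iterate-ascending k i)

    a-lub : O₁.IsSeqLubᵥ I₁.iterate a
    a-lub = I₁.isLeastFixedPoint⇒lub (proj₂ ∘ iterate-lub) a-lfp

module NaturalOrder {c ℓ : Level} (K : CommutativeSemiring c ℓ) (absorptive : Absorptive K) where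
  open CommutativeSemiring K
  open import Relation.Binary.Reasoning.Setoid setoid

  +-idem : ∀ a → a + a ≈ a
  +-idem a = begin
    a + a             ≈⟨ +-cong (*-identityʳ a) (*-identityʳ a) ⟨
    a * 1# + a * 1#   ≈⟨ distribˡ a 1# 1# ⟨
    a * (1# + 1#)     ≈⟨ *-cong refl (absorptive 1#) ⟩
    a * 1#            ≈⟨ *-identityʳ a ⟩
    a                 ∎

  ≤ₙ-isPartialOrder : IsPartialOrder _≈_ (_≤ₙ_ K)
  ≤ₙ-isPartialOrder = record
    { isPreorder = record
      { isEquivalence = isEquivalence
      ; reflexive = λ {x} {y} x≈y → trans (+-cong x≈y refl) (+-idem y)
      ; trans = λ {x} {y} {z} x≤y y≤z → begin
          x + z         ≈⟨ +-cong refl y≤z ⟨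
          x + (y + z)   ≈⟨ +-assoc x y z ⟨
          (x + y) + z   ≈⟨ +-cong x≤y refl ⟩
          y + z         ≈⟨ y≤z ⟩
          z             ∎
      }
    ; antisym = λ {x} {y} x≤y y≤x → trans (sym y≤x) (trans (+-comm y x) x≤y)
    }

  ≤ₙ-1# : ∀ a → _≤ₙ_ K a 1#
  ≤ₙ-1# a = trans (+-comm a 1#) (absorptive a)

  module _ (fullyContinuous : FullyContinuous K) where
    private
      +-continuousOp : ContinuousOp K _+_
      +-continuousOp = proj₁ (proj₂ fullyContinuous)

      *-continuousOp : ContinuousOp K _*_
      *-continuousOp = proj₂ (proj₂ fullyContinuous)

    naturalOrder : ChainContinuousOrder K
    naturalOrder = record
      { _⊑_ = _≤ₙ_ K
      ; isPartialOrder = ≤ₙ-isPartialOrder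
      ; +-continuous = λ a C ne chain → proj₁ (+-continuousOp a C ne chain)
      ; *-continuous = λ a C ne chain → proj₁ (*-continuousOp a C ne chain)
      ; ⊥ = 0#
      ; ⊥-least = +-identityˡ
      }

    dualNaturalOrder : ChainContinuousOrder K
    dualNaturalOrder = record
      { _⊑_ = flip (_≤ₙ_ K)
      ; isPartialOrder = Flip.isPartialOrder ≤ₙ-isPartialOrder
      ; +-continuous = λ a C ne chain → proj₂ (+-continuousOp a C ne (isChainOf-flip K chain))
      ; *-continuous = λ a C ne chain → proj₂ (*-continuousOp a C ne (isChainOf-flip K chain))
      ; ⊥ = 1#
      ; ⊥-least = ≤ₙ-1#
      }

open NaturalOrder using (naturalOrder; dualNaturalOrder)

lemma8 : {c ℓ : Level} (K₁ K₂ : CommutativeSemiring c ℓ)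
    → Absorptive K₁ → FullyContinuous K₁
    → Absorptive K₂ → FullyContinuous K₂
    → (h : CommutativeSemiring.Carrier K₁ → CommutativeSemiring.Carrier K₂)
    → IsFullyContinuousHom K₁ K₂ h
    → (n : ℕ) (E : EqSystem K₁ n)
    → (∀ a → IsLfp K₁ (F K₁ E) a → IsLfp K₂ (F K₂ (mapSystem K₁ K₂ h E)) (λ i → h (a i)))
      × (∀ a → IsGfp K₁ (F K₁ E) a → IsGfp K₂ (F K₂ (mapSystem K₁ K₂ h E)) (λ i → h (a i)))
lemma8 K₁ K₂ ab₁ fc₁ ab₂ fc₂ h (h-homo , h-continuous) n E =
  isLeastFixedPoint-map up₁ up₂ h-homo 0#-homo
    (chainContinuous⇒seqContinuous up₁ up₂ ⟦⟧-cong λ C ne chain → proj₁ (h-continuous C ne chain))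
    (λ f _ → proj₁ (proj₁ fc₁ (range K₁ f))) E ,
  isLeastFixedPoint-map down₁ down₂ h-homo 1#-homo
    (chainContinuous⇒seqContinuous down₁ down₂ ⟦⟧-cong
      λ C ne chain → proj₂ (h-continuous C ne (isChainOf-flip K₁ chain)))
    (λ f _ → proj₂ (proj₁ fc₁ (range K₁ f))) E
  where
  open SemiringMorphisms.IsSemiringHomomorphism h-homo using (0#-homo; 1#-homo; ⟦⟧-cong)
  up₁ down₁ : ChainContinuousOrder K₁
  up₁ = naturalOrder K₁ ab₁ fc₁
  down₁ = dualNaturalOrder K₁ ab₁ fc₁

  up₂ down₂ : ChainContinuousOrder K₂
  up₂ = naturalOrder K₂ ab₂ fc₂
  down₂ = dualNaturalOrder K₂ ab₂ fc₂
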